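{- Let $m\ge1$ and $N$ be positive integers. The greedy element and all optimal elements of $V_m(N)$ are $\tau$-monotonic.
   Context: Let $p$ be a prime, $s\ge1$. For a positive integer $N=\sum_j n_jp^j$ (base $p$), $\sigma(N)$ is the nondecreasing sequence of powers of $p$ in which each $p^j$ appears exactly $n_j$ times (so its terms sum to $N$); for $0\le h\le s-1$, $\tau_h(N)$ is the subsequence of $\sigma(N)$ consisting of the terms $p^k$ with $k\equiv h\pmod s$. $V_m(N)$ is the set of $m$-tuples $(X_1,\dots,X_m)$ of positive integers summing to $N$ with no carryover of $p$-adic digits in the sum (equivalently $\sigma(X_1),\dots,\sigma(X_m)$ partition the multiset $\sigma(N)$) and with $(p^s-1)\mid X_j$ for $1\le j\le m-1$. Weight: $wt(X)=\sum_{j=1}^m jX_j$; optimal = of maximal weight in $V_m(N)$; the greedy element is the $(G_1,\dots,G_m)\in V_m(N)$ with $(G_m,\dots,G_1)$ lexicographically largest. An element $X\in V_m(N)$ is $\tau$-monotonic if for all $1\le i<j\le m$ and $0\le h\le s-1$, every term of $\tau_h(X_i)$ is no larger than every term of $\tau_h(X_j)$ (equivalently, for each $h$, $\tau_h(N)$ is the concatenation of $\tau_h(X_1),\dots,\tau_h(X_m)$). -}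

module Defs where

open import Data.Nat using (ℕ; zero; suc; _+_; _*_; _∸_; _^_; _≤_; _<_)
open import Data.Nat.Properties using (_≟_)
open import Data.Nat.DivMod using (_/_; _%_)
open import Data.Nat.Divisibility using (_∣_)
open import Data.Fin using (Fin; toℕ) renaming (zero to fzero; suc to fsuc; _<_ to _<ᶠ_)
open import Data.List using (List; []; _∷_; map; replicate; concatMap; upTo; filter)
open import Data.List.Membership.Propositional using (_∈_)
open import Data.Product using (_×_; Σ; ∃)
open import Data.Sum using (_⊎_)
open import Relation.Binary.PropositionalEquality using (_≡_)

-- k-th base-p digit of N (p ≥ 2 in all uses; the p = 0 clause is a dummy).
digit : (p k N : ℕ) → ℕ
digit zero    k       N = 0
digit (suc q) zero    N = N % suc q
digit (suc q) (suc k) N = digit (suc q) k (N / suc q)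

-- Exponents occurring in σ(N), nondecreasing, exponent j repeated n_j times.
-- Digits beyond position N vanish (p^N > N for p ≥ 2), so range 0..N suffices.
σexp : (p N : ℕ) → List ℕ
σexp p N = concatMap (λ k → replicate (digit p k N) k) (upTo (suc N))

σ : (p N : ℕ) → List ℕ
σ p N = map (p ^_) (σexp p N)

-- k mod s (s ≥ 1 in all uses; the s = 0 clause is a dummy).
resid : (s k : ℕ) → ℕ
resid zero    k = k
resid (suc t) k = k % suc t

τ : (p s h N : ℕ) → List ℕ
τ p s h N = map (p ^_) (filter (λ k → resid s k ≟ h) (σexp p N))

sumF : ∀ {m} → (Fin m → ℕ) → ℕ
sumF {zero}  f = 0
sumF {suc m} f = f fzero + sumF (λ i → f (fsuc i))

-- m-tuples (X_1,…,X_m) are functions Fin m → ℕ; index i : Fin m is X_{toℕ i + 1}.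
Tuple : ℕ → Set
Tuple m = Fin m → ℕ

NoCarry : (p : ℕ) → ∀ {m} → Tuple m → Set
NoCarry p X = ∀ k → sumF (λ j → digit p k (X j)) < p

InV : (p s m N : ℕ) → Tuple m → Set
InV p s m N X =
  (∀ j → 0 < X j)
  × sumF X ≡ N
  × NoCarry p X
  × (∀ j → suc (toℕ j) ≤ m ∸ 1 → (p ^ s ∸ 1) ∣ X j)

wt : ∀ {m} → Tuple m → ℕ
wt X = sumF (λ j → suc (toℕ j) * X j)

_≤rlex_ : ∀ {m} → Tuple m → Tuple m → Set
_≤rlex_ {m} Y X =
  (∀ j → Y j ≡ X j)
  ⊎ Σ (Fin m) (λ i → Y i < X i × (∀ j → i <ᶠ j → Y j ≡ X j))

Optimal : (p s m N : ℕ) → Tuple m → Set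
Optimal p s m N X = InV p s m N X × (∀ Y → InV p s m N Y → wt Y ≤ wt X)

Greedy : (p s m N : ℕ) → Tuple m → Set
Greedy p s m N X = InV p s m N X × (∀ Y → InV p s m N Y → Y ≤rlex X)

TauMonotonic : (p s : ℕ) → ∀ {m} → Tuple m → Set
TauMonotonic p s X =
  ∀ i j → i <ᶠ j → ∀ h → h < s →
    ∀ x y → x ∈ τ p s h (X i) → y ∈ τ p s h (X j) → x ≤ y

{-# OPTIONS --safe #-}
module Submission where

-- Suppose X ∈ V_m(N) is not τ-monotonic: some p^a occurs in σ(X_i) and some p^b in σ(X_j)
-- with i < j, a ≡ b (mod s) and p^a > p^b. Trading them, X_i − p^a + p^b and X_j − p^b + p^a,
-- gives another element of V_m(N): the multiset of digits is unchanged, so there is still no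
-- carry, and since p^s ≡ 1 (mod p^s − 1) also p^a ≡ p^b, so divisibility by p^s − 1 survives.
-- The trade moves the amount p^a − p^b from index i to the larger index j, so the weight
-- strictly increases; and X_j grows while all later components are untouched, so the new
-- tuple is lexicographically larger. Hence neither an optimal nor the greedy element can
-- contain such a pair.

open import Defs
open import Data.Nat using (ℕ; zero; suc; _+_; _*_; _∸_; _^_; _≤_; _<_; z<s; s<s; NonZero)
open import Data.Nat.Properties
open import Data.Nat.DivMod
open import Data.Nat.Divisibility using (_∣_; divides-refl; ∣m+n∣m⇒∣n; ∣m∣n⇒∣m+n; n∣m*n)
open import Data.Nat.Primality using (Prime; ¬prime[0])
open import Data.Nat.Solver using (module +-*-Solver)
open import Algebra.Properties.CommutativeSemigroup +-commutativeSemigroup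
  using (interchange; xy∙z≈xz∙y; x∙yz≈xz∙y)
open import Data.Fin using (Fin; toℕ) renaming (zero to fzero; suc to fsuc; _<_ to _<ᶠ_)
import Data.Fin.Properties as Fin
open import Data.Vec.Functional using (updateAt)
open import Data.Vec.Functional.Properties using (updateAt-updates; updateAt-minimal)
open import Data.List using (replicate; upTo)
open import Data.List.Membership.Propositional using (_∈_)
open import Data.List.Membership.Propositional.Properties using (∈-map⁻; ∈-filter⁻; ∈-concatMap⁻)
open import Data.List.Relation.Unary.Any using (here; there; satisfied)
open import Data.Product using (_×_; ∃-syntax; _,_; proj₁; proj₂)
open import Data.Sum using (inj₁; inj₂)
open import Function using (_∘_; const)
open import Relation.Binary using (tri<; tri≈; tri>)
open import Relation.Binary.PropositionalEquality
open import Relation.Nullary using (¬_; yes; no; contradiction)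
open +-*-Solver using (solve; _:+_; _:*_; _:=_; con)
open ≡-Reasoning

add-balances : ∀ a b a′ b′ {c d c′ d′ : ℕ} → a + c ≡ b + d → a′ + c′ ≡ b′ + d′ →
               (a + a′) + (c + c′) ≡ (b + b′) + (d + d′)
add-balances a b a′ b′ {c} {d} {c′} {d′} e e′ = begin
  (a + a′) + (c + c′) ≡⟨ interchange a a′ c c′ ⟩
  (a + c) + (a′ + c′) ≡⟨ cong₂ _+_ e e′ ⟩
  (b + d) + (b′ + d′) ≡⟨ interchange b b′ d d′ ⟨
  (b + b′) + (d + d′) ∎

balance-< : ∀ {x y u v : ℕ} → y + u ≡ x + v → u < v → x < y
balance-< {x} {y} {u} {v} eq u<v = +-cancelʳ-< v x y (subst (_< y + v) eq (+-monoʳ-< y u<v))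

rearrangement-< : ∀ {x y A B : ℕ} → x < y → B < A → x * A + y * B < x * B + y * A
rearrangement-< {x} {y} {A} {B} x<y B<A with m≤n⇒∃[o]m+o≡n x<y
... | d , refl = subst₂ _<_
  (solve 4 (λ x d A B → (x :* A :+ x :* B) :+ (con 1 :+ d) :* B := x :* A :+ (con 1 :+ x :+ d) :* B)
           refl x d A B)
  (solve 4 (λ x d A B → (x :* A :+ x :* B) :+ (con 1 :+ d) :* A := x :* B :+ (con 1 :+ x :+ d) :* A)
           refl x d A B)
  (+-monoʳ-< (x * A + x * B) (*-monoʳ-< (suc d) B<A))

[r+[n+m]*k]≡[r+n*k]+k*m : ∀ r n m k → r + (n + m) * k ≡ (r + n * k) + k * m
[r+[n+m]*k]≡[r+n*k]+k*m = solve 4 (λ r n m k → r :+ (n :+ m) :* k := (r :+ n :* k) :+ k :* m) refl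

∣-cancel-+ˡ : ∀ {d x y u k} → y + (u + k * d) ≡ x + u → d ∣ x → d ∣ y
∣-cancel-+ˡ {d} {x} {y} {u} {k} eq d∣x = ∣m+n∣m⇒∣n (subst (d ∣_) x≡kd+y d∣x) (n∣m*n k)
  where
  x≡kd+y : x ≡ k * d + y
  x≡kd+y = +-cancelʳ-≡ u x (k * d + y) (begin
    x + u           ≡⟨ eq ⟨
    y + (u + k * d) ≡⟨ solve 4 (λ y u k d → y :+ (u :+ k :* d) := (k :* d :+ y) :+ u) refl y u k d ⟩
    (k * d + y) + u ∎)

∣-cancel-+ʳ : ∀ {d x y u k} → y + u ≡ x + (u + k * d) → d ∣ x → d ∣ y
∣-cancel-+ʳ {d} {x} {y} {u} {k} eq d∣x = subst (d ∣_) (sym y≡x+kd) (∣m∣n⇒∣m+n d∣x (n∣m*n k))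
  where
  y≡x+kd : y ≡ x + k * d
  y≡x+kd = +-cancelʳ-≡ u y (x + k * d) (begin
    y + u           ≡⟨ eq ⟩
    x + (u + k * d) ≡⟨ x∙yz≈xz∙y x u (k * d) ⟩
    (x + k * d) + u ∎)

[m+kn]%n≡m : ∀ m k n .{{_ : NonZero n}} → m < n → (m + k * n) % n ≡ m
[m+kn]%n≡m m k n m<n = trans ([m+kn]%n≡m%n m k n) (m<n⇒m%n≡m m<n)

[m+kn]/n≡k : ∀ m k n .{{_ : NonZero n}} → m < n → (m + k * n) / n ≡ k
[m+kn]/n≡k m k n m<n = begin
  (m + k * n) / n   ≡⟨ +-distrib-/-∣ʳ m (divides-refl k) ⟩
  m / n + k * n / n ≡⟨ cong₂ _+_ (m<n⇒m/n≡0 m<n) (m*n/n≡m k n) ⟩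
  k                 ∎

m%n≡o%n⇒m≡o+k*n : ∀ {m o} n .{{_ : NonZero n}} → m % n ≡ o % n → o ≤ m → ∃[ k ] m ≡ o + k * n
m%n≡o%n⇒m≡o+k*n {m} {o} n m%n≡o%n o≤m = k , (begin
  m                          ≡⟨ m≡m%n+[m/n]*n m n ⟩
  m % n + m / n * n          ≡⟨ cong₂ (λ r l → r + l * n) m%n≡o%n (sym (m+[n∸m]≡n (/-monoˡ-≤ n o≤m))) ⟩
  o % n + (o / n + k) * n    ≡⟨ [r+[n+m]*k]≡[r+n*k]+k*m (o % n) (o / n) k n ⟩
  o % n + o / n * n + n * k  ≡⟨ cong₂ _+_ (m≡m%n+[m/n]*n o n) (*-comm k n) ⟨
  o + k * n                  ∎)
  where
  k = m / n ∸ o / n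

[1+d]^n≡1+k*d : ∀ d n → ∃[ k ] suc d ^ n ≡ suc (k * d)
[1+d]^n≡1+k*d d zero    = 0 , refl
[1+d]^n≡1+k*d d (suc n) with [1+d]^n≡1+k*d d n
... | k , eq = suc k + k * d , (begin
  suc d * suc d ^ n         ≡⟨ cong (suc d *_) eq ⟩
  suc d * suc (k * d)       ≡⟨ solve 2 (λ k d → (con 1 :+ d) :* (con 1 :+ k :* d)
                                          := con 1 :+ (con 1 :+ k :+ k :* d) :* d) refl k d ⟩
  suc ((suc k + k * d) * d) ∎)

sumF-cong : ∀ {m} {f g : Fin m → ℕ} → (∀ l → f l ≡ g l) → sumF f ≡ sumF g
sumF-cong {zero}  f≗g = refl
sumF-cong {suc m} f≗g = cong₂ _+_ (f≗g fzero) (sumF-cong (f≗g ∘ fsuc))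

sumF-balance : ∀ {m} {f g : Fin m → ℕ} (i : Fin m) {c d} →
               (∀ l → l ≢ i → f l ≡ g l) → f i + c ≡ g i + d → sumF f + c ≡ sumF g + d
sumF-balance {f = f} {g} fzero {c} {d} agree fi = begin
  (f fzero + sumF (f ∘ fsuc)) + c ≡⟨ xy∙z≈xz∙y (f fzero) _ c ⟩
  (f fzero + c) + sumF (f ∘ fsuc) ≡⟨ cong₂ _+_ fi (sumF-cong (λ l → agree (fsuc l) λ ())) ⟩
  (g fzero + d) + sumF (g ∘ fsuc) ≡⟨ xy∙z≈xz∙y (g fzero) _ d ⟨
  (g fzero + sumF (g ∘ fsuc)) + d ∎
sumF-balance {f = f} {g} (fsuc i) agree fi = add-balances (f fzero) (g fzero) _ _
  (cong (_+ 0) (agree fzero λ ()))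
  (sumF-balance i (λ l l≢i → agree (fsuc l) (l≢i ∘ Fin.suc-injective)) fi)

sumF-balance₂ : ∀ {m} {f g : Fin m → ℕ} {i j : Fin m} {c d c′ d′} → i ≢ j →
                (∀ l → l ≢ i → l ≢ j → f l ≡ g l) →
                f i + c ≡ g i + d → f j + c′ ≡ g j + d′ → sumF f + (c + c′) ≡ sumF g + (d + d′)
sumF-balance₂ {i = fzero}  {fzero}  i≢j = contradiction refl i≢j
sumF-balance₂ {f = f} {g} {fzero} {fsuc j} _ agree fi fj = add-balances (f fzero) (g fzero) _ _ fi
  (sumF-balance j (λ l l≢j → agree (fsuc l) (λ ()) (l≢j ∘ Fin.suc-injective)) fj)
sumF-balance₂ {f = f} {g} {fsuc i} {fzero} {c} {d} {c′} {d′} _ agree fi fj = begin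
  sumF f + (c + c′)  ≡⟨ cong (sumF f +_) (+-comm c c′) ⟩
  sumF f + (c′ + c)  ≡⟨ add-balances (f fzero) (g fzero) _ _ fj
                          (sumF-balance i (λ l l≢i → agree (fsuc l) (l≢i ∘ Fin.suc-injective) λ ()) fi) ⟩
  sumF g + (d′ + d)  ≡⟨ cong (sumF g +_) (+-comm d′ d) ⟩
  sumF g + (d + d′)  ∎
sumF-balance₂ {f = f} {g} {fsuc i} {fsuc j} i≢j agree fi fj = add-balances (f fzero) (g fzero) _ _
  (cong (_+ 0) (agree fzero (λ ()) (λ ())))
  (sumF-balance₂ (i≢j ∘ cong fsuc)
    (λ l l≢i l≢j → agree (fsuc l) (l≢i ∘ Fin.suc-injective) (l≢j ∘ Fin.suc-injective)) fi fj)

≤-sumF : ∀ {m} (f : Fin m → ℕ) i → f i ≤ sumF f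
≤-sumF f fzero    = m≤m+n (f fzero) _
≤-sumF f (fsuc i) = ≤-trans (≤-sumF (f ∘ fsuc) i) (m≤n+m _ (f fzero))

+-≤-sumF : ∀ {m} (f : Fin m → ℕ) {i j} → i ≢ j → f i + f j ≤ sumF f
+-≤-sumF f {fzero}  {fzero}  i≢j = contradiction refl i≢j
+-≤-sumF f {fzero}  {fsuc j} _   = +-monoʳ-≤ (f fzero) (≤-sumF (f ∘ fsuc) j)
+-≤-sumF f {fsuc i} {fzero}  _   = subst (_≤ sumF f) (+-comm (f fzero) (f (fsuc i)))
                                         (+-monoʳ-≤ (f fzero) (≤-sumF (f ∘ fsuc) i))
+-≤-sumF f {fsuc i} {fsuc j} i≢j = ≤-trans (+-≤-sumF (f ∘ fsuc) (i≢j ∘ cong fsuc)) (m≤n+m _ (f fzero))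

increase-at⇒≰rlex : ∀ {m} {X Y : Tuple m} j → X j < Y j → (∀ l → j <ᶠ l → Y l ≡ X l) → ¬ (Y ≤rlex X)
increase-at⇒≰rlex j Xj<Yj above (inj₁ Y≗X) = <-irrefl (sym (Y≗X j)) Xj<Yj
increase-at⇒≰rlex j Xj<Yj above (inj₂ (l , Yl<Xl , fixed)) with Fin.<-cmp l j
... | tri< l<j _ _   = <-irrefl (sym (fixed j l<j)) Xj<Yj
... | tri≈ _ refl _  = <-asym Yl<Xl Xj<Yj
... | tri> _ _ j<l   = <-irrefl (above l j<l) Yl<Xl

∈-replicate⁻ : ∀ {A : Set} {x y : A} n → x ∈ replicate n y → x ≡ y × 0 < n
∈-replicate⁻ (suc n) (here x≡y) = x≡y , z<s
∈-replicate⁻ (suc n) (there x∈) = proj₁ (∈-replicate⁻ n x∈) , z<s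

∈τ⁻ : ∀ {p s h N x} → x ∈ τ p s h N → ∃[ a ] x ≡ p ^ a × resid s a ≡ h × 0 < digit p a N
∈τ⁻ {p} {s} {h} {N} x∈ with ∈-map⁻ (p ^_) x∈
... | a , a∈ , refl with ∈-filter⁻ (λ k → resid s k ≟ h) {xs = σexp p N} a∈
... | a∈σ , a≡h with satisfied (∈-concatMap⁻ (λ k → replicate (digit p k N) k) {xs = upTo (suc N)} a∈σ)
... | k , a∈rep with ∈-replicate⁻ (digit p k N) a∈rep
... | refl , 0<digit = a , refl , a≡h , 0<digit

δ : ℕ → ℕ → ℕ
δ zero    zero    = 1
δ zero    (suc _) = 0
δ (suc _) zero    = 0
δ (suc k) (suc b) = δ k b

δ-refl : ∀ k → δ k k ≡ 1
δ-refl zero    = refl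
δ-refl (suc k) = δ-refl k

δ-≢ : ∀ {k b} → k ≢ b → δ k b ≡ 0
δ-≢ {zero}  {zero}  k≢b = contradiction refl k≢b
δ-≢ {zero}  {suc b} _   = refl
δ-≢ {suc k} {zero}  _   = refl
δ-≢ {suc k} {suc b} k≢b = δ-≢ (k≢b ∘ cong suc)

-- digit computes only on a base of the form suc q.
module Digits (q : ℕ) where
  p : ℕ
  p = suc q

  digit-0 : ∀ k → digit p k 0 ≡ 0
  digit-0 zero    = refl
  digit-0 (suc k) = digit-0 k

  digit-zero-expansion : ∀ {r} n → r < p → digit p 0 (r + n * p) ≡ r
  digit-zero-expansion n r<p = [m+kn]%n≡m _ n p r<p

  digit-suc-expansion : ∀ {r} n k → r < p → digit p (suc k) (r + n * p) ≡ digit p k n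
  digit-suc-expansion n k r<p = cong (digit p k) ([m+kn]/n≡k _ n p r<p)

  digit-+-^ : ∀ b Z → suc (digit p b Z) < p → ∀ k → digit p k (Z + p ^ b) ≡ digit p k Z + δ k b
  digit-+-^ zero Z room k = trans (cong (digit p k) Z+1≡) (digits k)
    where
    Z+1≡ : Z + 1 ≡ suc (Z % p) + Z / p * p
    Z+1≡ = trans (cong (_+ 1) (m≡m%n+[m/n]*n Z p)) (+-comm _ 1)
    digits : ∀ k → digit p k (suc (Z % p) + Z / p * p) ≡ digit p k Z + δ k 0
    digits zero    = trans (digit-zero-expansion (Z / p) room) (+-comm 1 (Z % p))
    digits (suc k) = trans (digit-suc-expansion (Z / p) k room) (sym (+-identityʳ _))
  digit-+-^ (suc b) Z room k = trans (cong (digit p k) Z+pᵇ⁺¹≡) (digits k)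
    where
    Z+pᵇ⁺¹≡ : Z + p ^ suc b ≡ Z % p + (Z / p + p ^ b) * p
    Z+pᵇ⁺¹≡ = begin
      Z + p * p ^ b                   ≡⟨ cong (_+ p * p ^ b) (m≡m%n+[m/n]*n Z p) ⟩
      (Z % p + Z / p * p) + p * p ^ b ≡⟨ [r+[n+m]*k]≡[r+n*k]+k*m (Z % p) (Z / p) (p ^ b) p ⟨
      Z % p + (Z / p + p ^ b) * p     ∎
    digits : ∀ k → digit p k (Z % p + (Z / p + p ^ b) * p) ≡ digit p k Z + δ k (suc b)
    digits zero    = trans (digit-zero-expansion (Z / p + p ^ b) (m%n<n Z p)) (sym (+-identityʳ _))
    digits (suc k) = trans (digit-suc-expansion _ k (m%n<n Z p)) (digit-+-^ b (Z / p) room k)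

  split-off-^ : ∀ a X → 0 < digit p a X → ∃[ W ] X ≡ W + p ^ a × suc (digit p a W) < p
  split-off-^ zero X _ with X % p in X%p≡
  ... | suc r = r + X / p * p , X≡
              , subst (λ d → suc d < p) (sym (digit-zero-expansion (X / p) (<⇒≤ r+1<p))) r+1<p
    where
    r+1<p : suc r < p
    r+1<p = subst (_< p) X%p≡ (m%n<n X p)
    X≡ : X ≡ (r + X / p * p) + 1
    X≡ = begin
      X                   ≡⟨ m≡m%n+[m/n]*n X p ⟩
      X % p + X / p * p   ≡⟨ cong (_+ X / p * p) X%p≡ ⟩
      suc r + X / p * p   ≡⟨ +-comm (r + X / p * p) 1 ⟨
      r + X / p * p + 1   ∎
  split-off-^ (suc a) X a∈X with split-off-^ a (X / p) a∈X
  ... | W , X/p≡ , room = X % p + W * p , X≡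
                        , subst (λ d → suc d < p) (sym (digit-suc-expansion W a (m%n<n X p))) room
    where
    X≡ : X ≡ (X % p + W * p) + p ^ suc a
    X≡ = begin
      X                           ≡⟨ m≡m%n+[m/n]*n X p ⟩
      X % p + X / p * p           ≡⟨ cong (λ n → X % p + n * p) X/p≡ ⟩
      X % p + (W + p ^ a) * p     ≡⟨ [r+[n+m]*k]≡[r+n*k]+k*m (X % p) W (p ^ a) p ⟩
      (X % p + W * p) + p ^ suc a ∎

  record Exchange (a b X Y : ℕ) : Set where
    field
      value  : Y + p ^ a ≡ X + p ^ b
      digits : ∀ k → digit p k Y + δ k a ≡ digit p k X + δ k b

  exchange : ∀ {a b X} → a ≢ b → 0 < digit p a X → suc (digit p b X) < p → ∃[ Y ] Exchange a b X Y
  exchange {a} {b} {X} a≢b a∈X room with split-off-^ a X a∈X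
  ... | W , X≡W+pᵃ , roomᵃ = W + p ^ b , record { value = value ; digits = digits }
    where
    digits-X : ∀ k → digit p k X ≡ digit p k W + δ k a
    digits-X k = trans (cong (digit p k) X≡W+pᵃ) (digit-+-^ a W roomᵃ k)
    roomᵇ : suc (digit p b W) < p
    roomᵇ = subst (λ d → suc d < p)
              (trans (digits-X b) (trans (cong (_ +_) (δ-≢ (a≢b ∘ sym))) (+-identityʳ _))) room
    value : (W + p ^ b) + p ^ a ≡ X + p ^ b
    value = trans (xy∙z≈xz∙y W (p ^ b) (p ^ a)) (cong (_+ p ^ b) (sym X≡W+pᵃ))
    digits : ∀ k → digit p k (W + p ^ b) + δ k a ≡ digit p k X + δ k b
    digits k = begin
      digit p k (W + p ^ b) + δ k a   ≡⟨ cong (_+ δ k a) (digit-+-^ b W roomᵇ k) ⟩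
      digit p k W + δ k b + δ k a     ≡⟨ xy∙z≈xz∙y (digit p k W) (δ k b) (δ k a) ⟩
      digit p k W + δ k a + δ k b     ≡⟨ cong (_+ δ k b) (digits-X k) ⟨
      digit p k X + δ k b             ∎

  exchange-positive : ∀ {a b X Y} → a ≢ b → Exchange a b X Y → 0 < Y
  exchange-positive {a} {b} {X} {Y} a≢b ex = n≢0⇒n>0 Y≢0
    where
    Y≢0 : Y ≢ 0
    Y≢0 refl = 0≢1+n (begin
      0                    ≡⟨ cong₂ _+_ (digit-0 b) (δ-≢ (a≢b ∘ sym)) ⟨
      digit p b 0 + δ b a  ≡⟨ Exchange.digits ex b ⟩
      digit p b X + δ b b  ≡⟨ cong (digit p b X +_) (δ-refl b) ⟩
      digit p b X + 1      ≡⟨ +-comm (digit p b X) 1 ⟩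
      suc (digit p b X)    ∎)

module Improvement (q t : ℕ) where
  open Digits q

  s D : ℕ
  s = suc t
  D = p ^ s ∸ 1

  pᵃ≡pᵇ+e*D : ∀ {a b} → a % s ≡ b % s → b ≤ a → ∃[ e ] p ^ a ≡ p ^ b + e * D
  pᵃ≡pᵇ+e*D {a} {b} a%s≡b%s b≤a with m%n≡o%n⇒m≡o+k*n s a%s≡b%s b≤a
  ... | T , refl with [1+d]^n≡1+k*d D T
  ... | k , [1+D]ᵀ≡ = p ^ b * k , (begin
    p ^ (b + T * s)        ≡⟨ ^-distribˡ-+-* p b (T * s) ⟩
    p ^ b * p ^ (T * s)    ≡⟨ cong (λ n → p ^ b * p ^ n) (*-comm T s) ⟩
    p ^ b * p ^ (s * T)    ≡⟨ cong (p ^ b *_) (^-*-assoc p s T) ⟨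
    p ^ b * (p ^ s) ^ T    ≡⟨ cong (λ n → p ^ b * n ^ T) (m+[n∸m]≡n (m^n>0 p s)) ⟨
    p ^ b * suc D ^ T      ≡⟨ cong (p ^ b *_) [1+D]ᵀ≡ ⟩
    p ^ b * suc (k * D)    ≡⟨ solve 3 (λ x k D → x :* (con 1 :+ k :* D) := x :+ (x :* k) :* D) refl (p ^ b) k D ⟩
    p ^ b + p ^ b * k * D  ∎)

  record Inversion {m} (X : Tuple m) : Set where
    constructor inversion
    field
      i j          : Fin m
      i<j          : i <ᶠ j
      a b          : ℕ
      a∈Xi         : 0 < digit p a (X i)
      b∈Xj         : 0 < digit p b (X j)
      same-residue : resid s a ≡ resid s b
      pᵇ<pᵃ        : p ^ b < p ^ a

  ¬Inversion⇒TauMonotonic : ∀ {m} (X : Tuple m) → ¬ Inversion X → TauMonotonic p s X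
  ¬Inversion⇒TauMonotonic X noInversion i j i<j h _ x y x∈ y∈ with ∈τ⁻ x∈ | ∈τ⁻ y∈
  ... | a , refl , a≡h , a∈Xi | b , refl , b≡h , b∈Xj = ≮⇒≥ λ pᵇ<pᵃ →
    noInversion (inversion i j i<j a b a∈Xi b∈Xj (trans a≡h (sym b≡h)) pᵇ<pᵃ)

  module Exchanged {m N} {X : Tuple m}
    (X>0 : ∀ l → 0 < X l) (ΣX≡N : sumF X ≡ N) (noCarry : NoCarry p X)
    (D∣X : ∀ l → suc (toℕ l) ≤ m ∸ 1 → D ∣ X l) (inv : Inversion X) where
    open Inversion inv

    i≢j : i ≢ j
    i≢j refl = <-irrefl refl i<j

    a≢b : a ≢ b
    a≢b refl = <-irrefl refl pᵇ<pᵃ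

    b≤a : b ≤ a
    b≤a = ≮⇒≥ λ a<b → <⇒≱ pᵇ<pᵃ (^-monoʳ-≤ p (<⇒≤ a<b))

    digits-fit : ∀ {l l′} → l ≢ l′ → ∀ k → digit p k (X l) + digit p k (X l′) < p
    digits-fit l≢l′ k = ≤-<-trans (+-≤-sumF (λ l → digit p k (X l)) l≢l′) (noCarry k)

    Yᵢ-exchange : ∃[ Yᵢ ] Exchange a b (X i) Yᵢ
    Yᵢ-exchange = exchange a≢b a∈Xi (≤-<-trans (+-monoˡ-≤ _ b∈Xj) (digits-fit (i≢j ∘ sym) b))

    Yⱼ-exchange : ∃[ Yⱼ ] Exchange b a (X j) Yⱼ
    Yⱼ-exchange = exchange (a≢b ∘ sym) b∈Xj (≤-<-trans (+-monoˡ-≤ _ a∈Xi) (digits-fit i≢j a))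

    Yᵢ Yⱼ : ℕ
    Yᵢ = proj₁ Yᵢ-exchange
    Yⱼ = proj₁ Yⱼ-exchange
    module Eᵢ = Exchange (proj₂ Yᵢ-exchange)
    module Eⱼ = Exchange (proj₂ Yⱼ-exchange)

    Y : Tuple m
    Y = updateAt (updateAt X i (const Yᵢ)) j (const Yⱼ)

    Y-i : Y i ≡ Yᵢ
    Y-i = trans (updateAt-minimal i j _ i≢j) (updateAt-updates i X)

    Y-j : Y j ≡ Yⱼ
    Y-j = updateAt-updates j _

    Y-other : ∀ l → l ≢ i → l ≢ j → Y l ≡ X l
    Y-other l l≢i l≢j = trans (updateAt-minimal l j _ l≢j) (updateAt-minimal l i X l≢i)

    Y-elim : (P : Fin m → ℕ → Set) → P i Yᵢ → P j Yⱼ → (∀ l → l ≢ i → l ≢ j → P l (X l)) →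
             ∀ l → P l (Y l)
    Y-elim P Pᵢ Pⱼ Pₗ l with l Fin.≟ i | l Fin.≟ j
    ... | yes refl | _        = subst (P l) (sym Y-i) Pᵢ
    ... | no _     | yes refl = subst (P l) (sym Y-j) Pⱼ
    ... | no l≢i   | no l≢j   = subst (P l) (sym (Y-other l l≢i l≢j)) (Pₗ l l≢i l≢j)

    sumF-Y-balance : (f : Fin m → ℕ → ℕ) {c d c′ d′ : ℕ} →
                     f i Yᵢ + c ≡ f i (X i) + d → f j Yⱼ + c′ ≡ f j (X j) + d′ →
                     sumF (λ l → f l (Y l)) + (c + c′) ≡ sumF (λ l → f l (X l)) + (d + d′)
    sumF-Y-balance f {c} {d} {c′} fi fj =
      sumF-balance₂ i≢j (λ l l≢i l≢j → cong (f l) (Y-other l l≢i l≢j))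
      (trans (cong (λ y → f i y + c) Y-i) fi) (trans (cong (λ y → f j y + c′) Y-j) fj)

    sumF-Y≡sumF-X : (f : Fin m → ℕ → ℕ) {c d : ℕ} →
                    f i Yᵢ + c ≡ f i (X i) + d → f j Yⱼ + d ≡ f j (X j) + c →
                    sumF (λ l → f l (Y l)) ≡ sumF (λ l → f l (X l))
    sumF-Y≡sumF-X f {c} {d} fi fj = +-cancelʳ-≡ (c + d) _ _
      (trans (sumF-Y-balance f fi fj) (cong (sumF (λ l → f l (X l)) +_) (+-comm d c)))

    Y>0 : ∀ l → 0 < Y l
    Y>0 = Y-elim (λ _ y → 0 < y) (exchange-positive a≢b (proj₂ Yᵢ-exchange))
                 (exchange-positive (a≢b ∘ sym) (proj₂ Yⱼ-exchange)) (λ l _ _ → X>0 l)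

    ΣY≡N : sumF Y ≡ N
    ΣY≡N = trans (sumF-Y≡sumF-X (λ _ y → y) Eᵢ.value Eⱼ.value) ΣX≡N

    noCarry-Y : NoCarry p Y
    noCarry-Y k =
      subst (_< p) (sym (sumF-Y≡sumF-X (λ _ → digit p k) (Eᵢ.digits k) (Eⱼ.digits k))) (noCarry k)

    D∣Y : ∀ l → suc (toℕ l) ≤ m ∸ 1 → D ∣ Y l
    D∣Y with pᵃ≡pᵇ+e*D same-residue b≤a
    ... | e , pᵃ≡ = Y-elim (λ l y → suc (toℕ l) ≤ m ∸ 1 → D ∣ y)
      (λ i<m-1 → ∣-cancel-+ˡ {k = e} (subst (λ n → Yᵢ + n ≡ X i + p ^ b) pᵃ≡ Eᵢ.value) (D∣X i i<m-1))
      (λ j<m-1 → ∣-cancel-+ʳ {k = e} (subst (λ n → Yⱼ + p ^ b ≡ X j + n) pᵃ≡ Eⱼ.value) (D∣X j j<m-1))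
      (λ l _ _ → D∣X l)

    Y∈V : InV p s m N Y
    Y∈V = Y>0 , ΣY≡N , noCarry-Y , D∣Y

    wt-< : wt X < wt Y
    wt-< = balance-<
      (sumF-Y-balance (λ l y → suc (toℕ l) * y)
        (scale (suc (toℕ i)) Yᵢ (X i) Eᵢ.value) (scale (suc (toℕ j)) Yⱼ (X j) Eⱼ.value))
      (rearrangement-< (s<s i<j) pᵇ<pᵃ)
      where
      scale : ∀ c x y {u v} → x + u ≡ y + v → c * x + c * u ≡ c * y + c * v
      scale c x y {u} {v} eq = begin
        c * x + c * u ≡⟨ *-distribˡ-+ c x u ⟨
        c * (x + u)   ≡⟨ cong (c *_) eq ⟩
        c * (y + v)   ≡⟨ *-distribˡ-+ c y v ⟩
        c * y + c * v ∎

    Y≰X : ¬ (Y ≤rlex X)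
    Y≰X = increase-at⇒≰rlex j (subst (X j <_) (sym Y-j) (balance-< Eⱼ.value pᵇ<pᵃ))
      λ l j<l → Y-other l (λ { refl → <-asym i<j j<l }) (λ { refl → <-irrefl refl j<l })

  improve : ∀ {m N} {X : Tuple m} → InV p s m N X → Inversion X →
            ∃[ Y ] InV p s m N Y × wt X < wt Y × ¬ (Y ≤rlex X)
  improve (X>0 , ΣX≡N , noCarry , D∣X) inv = Y , Y∈V , wt-< , Y≰X
    where open Exchanged X>0 ΣX≡N noCarry D∣X inv

-- Primality is only used to exclude p = 0.
lemma3p1 : (p s m N : ℕ) → Prime p → 1 ≤ s → 1 ≤ m → 1 ≤ N →
    (∀ X → Greedy p s m N X → TauMonotonic p s X)
    × (∀ X → Optimal p s m N X → TauMonotonic p s X)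
lemma3p1 zero    _       _ _ p-prime _  _ _ = contradiction p-prime ¬prime[0]
lemma3p1 (suc q) zero    _ _ _       () _ _
lemma3p1 (suc q) (suc t) m N _       _  _ _ = greedy-monotonic , optimal-monotonic
  where
  open Digits q using (p)
  open Improvement q t

  greedy-monotonic : ∀ X → Greedy p s m N X → TauMonotonic p s X
  greedy-monotonic X (X∈V , lex-largest) = ¬Inversion⇒TauMonotonic X λ inv →
    let (Y , Y∈V , _ , Y≰X) = improve X∈V inv in Y≰X (lex-largest Y Y∈V)

  optimal-monotonic : ∀ X → Optimal p s m N X → TauMonotonic p s X
  optimal-monotonic X (X∈V , heaviest) = ¬Inversion⇒TauMonotonic X λ inv →
    let (Y , Y∈V , wtX<wtY , _) = improve X∈V inv in <⇒≱ wtX<wtY (heaviest Y Y∈V)
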